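{- Let $m$ be even with $m\ge 6$. Then $A_m(\beta_m-1)=\frac m2-1$, $A_m(2)=m-2$, $A_m(3)=\frac{m(m-3)}{2}$, $A_m(\beta_m-2)=\frac{m^2}{4}-\frac m2$, $A_m(4)=\frac{(m-2)(m+2)(m-3)}{6}$, and $A_m(\beta_m-3)=\frac{1}{12}m^3-\frac18 m^2-\frac1{12}m-1$.
   Context: $d_m(q)=\sum_{\pi\in D_m}q^{\mathrm{maj}(\pi)}$, where $D_m$ is the set of derangements of $\{1,\dots,m\}$ and $\mathrm{maj}$ is the major index; equivalently $d_1(q)=0$ and $d_n(q)=(1+q+\cdots+q^{n-1})d_{n-1}(q)+(-1)^nq^{\binom n2}$ for $n\ge2$. For $m$ even, the degree of $d_m(q)$ is $\beta_m=\binom m2$, and $A_m(k)$ denotes the coefficient of $q^k$ in $d_m(q)$. -}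

module Defs where

open import Data.Nat using (ℕ; zero; suc; _≤?_; _∸_; _≟_)
open import Data.Nat.Combinatorics using (_C_)
open import Data.Integer using (ℤ; 0ℤ; 1ℤ; -_; _+_; _*_)
open import Relation.Nullary using (yes; no)

-- A polynomial in q with integer coefficients is represented by its
-- coefficient function: p k = coefficient of q^k.
Poly : Set
Poly = ℕ → ℤ

sumBelow : ℕ → (ℕ → ℤ) → ℤ
sumBelow zero    f = 0ℤ
sumBelow (suc n) f = sumBelow n f + f n

mulGeom : ℕ → Poly → Poly
mulGeom n p k = sumBelow n (λ j → term j)
  where
  term : ℕ → ℤ
  term j with j ≤? k
  ... | yes _ = p (k ∸ j)
  ... | no  _ = 0ℤ

signPow : ℕ → ℤ
signPow zero    = 1ℤ
signPow (suc n) = - signPow n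

signMono : ℕ → Poly
signMono n k with k ≟ (n C 2)
... | yes _ = signPow n
... | no  _ = 0ℤ

-- d_n(q): d_0 is unused (set to 0), d_1 = 0,
-- d_n = (1 + ... + q^(n-1)) d_(n-1) + (-1)^n q^(n choose 2) for n ≥ 2.
d : ℕ → Poly
d zero          = λ _ → 0ℤ
d (suc zero)    = λ _ → 0ℤ
d (suc (suc n)) = λ k → mulGeom (suc (suc n)) (d (suc n)) k + signMono (suc (suc n)) k

A : ℕ → ℕ → ℤ
A m k = d m k

β : ℕ → ℕ
β m = m C 2

-- For k < n the coefficient of q^k in (1 + q + ⋯ + q^(n-1)) p is p k + ⋯ + p 0, and
-- dually the coefficient i places below the top is a partial sum of the top coefficients
-- of p.  Hence the five lowest and the four highest coefficients of d_m follow from those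
-- of d_(m-1), the sign (-1)^m entering only at the very top, and induction from d_5 gives
-- closed forms.  Carrying s = (-1)^m as a variable makes the top formulas uniform in the
-- parity of m; the theorem is the case s = 1.
module Submission where

open import Defs
open import Data.Nat using (ℕ; _≤_; _∸_)
open import Data.Nat.Divisibility using (_∣_)
open import Data.Integer using (ℤ; +_; _+_; _-_; _*_)
open import Data.Product using (_×_)
open import Relation.Binary.PropositionalEquality using (_≡_)

open import Data.Nat as ℕ using (zero; suc; _<_; _≤?_; _≟_; z≤n; s≤s)
import Data.Nat.Properties as ℕₚ
open import Data.Nat.Combinatorics using (nC1≡n; nCk+nC[k+1]≡[n+1]C[k+1])
open import Data.Nat.Divisibility using (divides)
open import Data.Integer using (0ℤ; 1ℤ; -_)
open import Data.Integer.Properties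
  using (+-assoc; +-identityˡ; +-identityʳ; neg-involutive; *-cancelˡ-≡)
open import Data.Integer.Tactic.RingSolver using (solve)
open import Data.List using ([]; _∷_)
open import Data.Product using (_,_)
open import Data.Empty using (⊥-elim)
open import Relation.Nullary using (yes; no)
open import Relation.Binary.PropositionalEquality
  using (_≢_; refl; sym; trans; cong; cong₂; subst; module ≡-Reasoning)
open ≡-Reasoning

β-suc : ∀ n → β (suc n) ≡ n ℕ.+ β n
β-suc n = trans (sym (nCk+nC[k+1]≡[n+1]C[k+1] n 1)) (cong (ℕ._+ β n) (nC1≡n n))

n≤β[1+n] : ∀ n → n ≤ β (suc n)
n≤β[1+n] n = subst (n ≤_) (sym (β-suc n)) (ℕₚ.m≤m+n n (β n))

sumBelow-cong : ∀ n {f g : ℕ → ℤ} → (∀ j → j < n → f j ≡ g j) → sumBelow n f ≡ sumBelow n g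
sumBelow-cong zero    f≡g = refl
sumBelow-cong (suc n) f≡g =
  cong₂ _+_ (sumBelow-cong n (λ j j<n → f≡g j (ℕₚ.m<n⇒m<1+n j<n))) (f≡g n ℕₚ.≤-refl)

sumBelow-zero : ∀ n {f : ℕ → ℤ} → (∀ j → j < n → f j ≡ 0ℤ) → sumBelow n f ≡ 0ℤ
sumBelow-zero zero    f≡0 = refl
sumBelow-zero (suc n) f≡0 =
  cong₂ _+_ (sumBelow-zero n (λ j j<n → f≡0 j (ℕₚ.m<n⇒m<1+n j<n))) (f≡0 n ℕₚ.≤-refl)

sumBelow-+ : ∀ m n (f : ℕ → ℤ) →
  sumBelow (m ℕ.+ n) f ≡ sumBelow m f + sumBelow n (λ j → f (m ℕ.+ j))
sumBelow-+ m zero    f = begin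
  sumBelow (m ℕ.+ 0) f ≡⟨ cong (λ k → sumBelow k f) (ℕₚ.+-identityʳ m) ⟩
  sumBelow m f         ≡⟨ sym (+-identityʳ _) ⟩
  sumBelow m f + 0ℤ    ∎
sumBelow-+ m (suc n) f = begin
  sumBelow (m ℕ.+ suc n) f                     ≡⟨ cong (λ k → sumBelow k f) (ℕₚ.+-suc m n) ⟩
  sumBelow (m ℕ.+ n) f + f (m ℕ.+ n)           ≡⟨ cong (_+ f (m ℕ.+ n)) (sumBelow-+ m n f) ⟩
  sumBelow m f + sumBelow n g + f (m ℕ.+ n)    ≡⟨ +-assoc (sumBelow m f) _ _ ⟩
  sumBelow m f + (sumBelow n g + f (m ℕ.+ n))  ∎
  where
  g : ℕ → ℤ
  g j = f (m ℕ.+ j)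

VanishesAbove : ℕ → Poly → Set
VanishesAbove X p = ∀ k → X < k → p k ≡ 0ℤ

shift : ℕ → Poly → Poly
shift j p k with j ≤? k
... | yes _ = p (k ∸ j)
... | no  _ = 0ℤ

shift-≤ : ∀ {j k} p → j ≤ k → shift j p k ≡ p (k ∸ j)
shift-≤ {j} {k} p j≤k with j ≤? k
... | yes _   = refl
... | no  j≰k = ⊥-elim (j≰k j≤k)

shift-< : ∀ {j k} p → k < j → shift j p k ≡ 0ℤ
shift-< {j} {k} p k<j with j ≤? k
... | yes j≤k = ⊥-elim (ℕₚ.<⇒≱ k<j j≤k)
... | no  _   = refl

shift-vanishes : ∀ {X} {p} j → VanishesAbove X p → VanishesAbove (j ℕ.+ X) (shift j p)
shift-vanishes {X} j vanishes k j+X<k with j ≤? k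
... | no  _ = refl
... | yes _ = vanishes (k ∸ j) (ℕₚ.m+n≤o⇒m≤o∸n (suc X) (subst (_< k) (ℕₚ.+-comm j X) j+X<k))

mulGeom-shift : ∀ n p k → mulGeom n p k ≡ sumBelow n (λ j → shift j p k)
mulGeom-shift zero    p k = refl
mulGeom-shift (suc n) p k with n ≤? k
... | yes _ = cong (_+ p (k ∸ n)) (mulGeom-shift n p k)
... | no  _ = cong (_+ 0ℤ) (mulGeom-shift n p k)

mulGeom-vanishes : ∀ {X} {p} a → VanishesAbove X p → VanishesAbove (a ℕ.+ X) (mulGeom (suc a) p)
mulGeom-vanishes {X} {p} a vanishes k a+X<k =
  trans (mulGeom-shift (suc a) p k) (sumBelow-zero (suc a) λ j j<1+a →
    shift-vanishes j vanishes k (ℕₚ.≤-<-trans (ℕₚ.+-monoˡ-≤ X (ℕₚ.≤-pred j<1+a)) a+X<k))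

mulGeom-low : ∀ {n k} p → k < n → mulGeom n p k ≡ sumBelow (suc k) (λ j → p (k ∸ j))
mulGeom-low {k = k} p k<n with ℕₚ.m≤n⇒∃[o]m+o≡n k<n
... | r , refl = begin
  mulGeom (suc k ℕ.+ r) p k
    ≡⟨ mulGeom-shift (suc k ℕ.+ r) p k ⟩
  sumBelow (suc k ℕ.+ r) (λ j → shift j p k)
    ≡⟨ sumBelow-+ (suc k) r _ ⟩
  sumBelow (suc k) (λ j → shift j p k) + sumBelow r (λ j → shift (suc k ℕ.+ j) p k)
    ≡⟨ cong₂ _+_ (sumBelow-cong (suc k) (λ j j<1+k → shift-≤ p (ℕₚ.≤-pred j<1+k)))
                 (sumBelow-zero r (λ j _ → shift-< p (ℕₚ.m≤m+n (suc k) j))) ⟩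
  sumBelow (suc k) (λ j → p (k ∸ j)) + 0ℤ
    ≡⟨ +-identityʳ _ ⟩
  sumBelow (suc k) (λ j → p (k ∸ j)) ∎

mulGeom-top : ∀ {X i a} {p} → VanishesAbove X p → i ≤ X → i ≤ a →
  mulGeom (suc a) p ((a ℕ.+ X) ∸ i) ≡ sumBelow (suc i) (λ t → p (X ∸ t))
mulGeom-top {X} {i} {p = p} vanishes i≤X i≤a with ℕₚ.m≤n⇒∃[o]m+o≡n i≤a
... | b , refl = begin
  mulGeom (suc (i ℕ.+ b)) p ((i ℕ.+ b ℕ.+ X) ∸ i)
    ≡⟨ cong₂ (λ n k → mulGeom n p k) length index ⟩
  mulGeom (b ℕ.+ suc i) p (b ℕ.+ X)
    ≡⟨ mulGeom-shift (b ℕ.+ suc i) p (b ℕ.+ X) ⟩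
  sumBelow (b ℕ.+ suc i) (λ j → shift j p (b ℕ.+ X))
    ≡⟨ sumBelow-+ b (suc i) _ ⟩
  sumBelow b (λ j → shift j p (b ℕ.+ X)) + sumBelow (suc i) (λ t → shift (b ℕ.+ t) p (b ℕ.+ X))
    ≡⟨ cong₂ _+_ (sumBelow-zero b λ j j<b → shift-vanishes j vanishes (b ℕ.+ X) (ℕₚ.+-monoˡ-< X j<b))
                 (sumBelow-cong (suc i) λ t t<1+i → top-term (ℕₚ.≤-trans (ℕₚ.≤-pred t<1+i) i≤X)) ⟩
  0ℤ + sumBelow (suc i) (λ t → p (X ∸ t))
    ≡⟨ +-identityˡ _ ⟩
  sumBelow (suc i) (λ t → p (X ∸ t)) ∎
  where
  length : suc (i ℕ.+ b) ≡ b ℕ.+ suc i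
  length = trans (cong suc (ℕₚ.+-comm i b)) (sym (ℕₚ.+-suc b i))
  index : (i ℕ.+ b ℕ.+ X) ∸ i ≡ b ℕ.+ X
  index = trans (cong (_∸ i) (ℕₚ.+-assoc i b X)) (ℕₚ.m+n∸m≡n i (b ℕ.+ X))
  top-term : ∀ {t} → t ≤ X → shift (b ℕ.+ t) p (b ℕ.+ X) ≡ p (X ∸ t)
  top-term {t} t≤X = trans (shift-≤ p (ℕₚ.+-monoʳ-≤ b t≤X)) (cong p (ℕₚ.[m+n]∸[m+o]≡n∸o b X t))

constant : ℤ → Poly
constant c zero    = c
constant c (suc _) = 0ℤ

signMono-off : ∀ n {k} → k ≢ β n → signMono n k ≡ 0ℤ
signMono-off n {k} k≢β with k ≟ β n
... | yes k≡β = ⊥-elim (k≢β k≡β)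
... | no  _   = refl

signMono-top : ∀ n {i} → i ≤ β n → signMono n (β n ∸ i) ≡ constant (signPow n) i
signMono-top n {zero} _ with β n ≟ β n
... | yes _   = refl
... | no  β≢β = ⊥-elim (β≢β refl)
signMono-top n {suc i} 1+i≤β =
  signMono-off n (ℕₚ.<⇒≢ (ℕₚ.∸-monoʳ-< {β n} {suc i} {0} (s≤s z≤n) 1+i≤β))

d-vanishes : ∀ n → VanishesAbove (β n) (d n)
d-vanishes zero          k _   = refl
d-vanishes (suc zero)    k _   = refl
d-vanishes (suc (suc n)) k β<k = cong₂ _+_
  (mulGeom-vanishes (suc n) (d-vanishes (suc n)) k (subst (_< k) (β-suc (suc n)) β<k))
  (signMono-off (suc (suc n)) (ℕₚ.>⇒≢ β<k))

d-low : ∀ n {k} → k ≤ n → d (suc (suc n)) k ≡ sumBelow (suc k) (λ j → d (suc n) (k ∸ j))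
d-low n k≤n = trans
  (cong₂ _+_ (mulGeom-low (d (suc n)) (ℕₚ.m<n⇒m<1+n (s≤s k≤n)))
             (signMono-off (suc (suc n)) (ℕₚ.<⇒≢ (ℕₚ.≤-trans (s≤s k≤n) (n≤β[1+n] (suc n))))))
  (+-identityʳ _)

d-top : ∀ n {i} → i ≤ n →
  d (suc (suc n)) (β (suc (suc n)) ∸ i)
    ≡ sumBelow (suc i) (λ t → d (suc n) (β (suc n) ∸ t)) + constant (signPow (suc (suc n))) i
d-top n {i} i≤n = cong₂ _+_
  (trans (cong (λ k → mulGeom (suc (suc n)) (d (suc n)) (k ∸ i)) (β-suc (suc n)))
         (mulGeom-top (d-vanishes (suc n)) (ℕₚ.≤-trans i≤n (n≤β[1+n] n)) (ℕₚ.m≤n⇒m≤1+n i≤n)))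
  (signMono-top (suc (suc n)) (ℕₚ.≤-trans i≤n (ℕₚ.≤-trans (ℕₚ.n≤1+n n) (n≤β[1+n] (suc n)))))

record LowFormulas (M a₀ a₁ a₂ a₃ a₄ : ℤ) : Set where
  constructor low-formulas
  field
    eq₀ : a₀ ≡ 0ℤ
    eq₁ : a₁ ≡ 1ℤ
    eq₂ : a₂ ≡ M - + 2
    eq₃ : + 2 * a₃ ≡ M * (M - + 3)
    eq₄ : + 6 * a₄ ≡ (M - + 2) * (M + + 2) * (M - + 3)

LowFormulas-resp : ∀ {M a₀ a₁ a₂ a₃ a₄ b₀ b₁ b₂ b₃ b₄} →
  a₀ ≡ b₀ → a₁ ≡ b₁ → a₂ ≡ b₂ → a₃ ≡ b₃ → a₄ ≡ b₄ →
  LowFormulas M a₀ a₁ a₂ a₃ a₄ → LowFormulas M b₀ b₁ b₂ b₃ b₄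
LowFormulas-resp refl refl refl refl refl formulas = formulas

low-formulas-step : ∀ {M a₀ a₁ a₂ a₃ a₄} → LowFormulas M a₀ a₁ a₂ a₃ a₄ →
  LowFormulas (1ℤ + M) (0ℤ + a₀) (0ℤ + a₁ + a₀) (0ℤ + a₂ + a₁ + a₀)
                       (0ℤ + a₃ + a₂ + a₁ + a₀) (0ℤ + a₄ + a₃ + a₂ + a₁ + a₀)
low-formulas-step {M} {a₃ = a₃} {a₄} (low-formulas refl refl refl h₃ h₄) =
  low-formulas refl refl (solve (M ∷ [])) step₃ step₄
  where
  step₃ : + 2 * (0ℤ + a₃ + (M - + 2) + 1ℤ + 0ℤ) ≡ (1ℤ + M) * ((1ℤ + M) - + 3)
  step₃ = begin
    + 2 * (0ℤ + a₃ + (M - + 2) + 1ℤ + 0ℤ) ≡⟨ solve (M ∷ a₃ ∷ []) ⟩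
    + 2 * a₃ + (+ 2 * M - + 2)            ≡⟨ cong (_+ (+ 2 * M - + 2)) h₃ ⟩
    M * (M - + 3) + (+ 2 * M - + 2)       ≡⟨ solve (M ∷ []) ⟩
    (1ℤ + M) * ((1ℤ + M) - + 3)           ∎
  step₄ : + 6 * (0ℤ + a₄ + a₃ + (M - + 2) + 1ℤ + 0ℤ)
          ≡ ((1ℤ + M) - + 2) * ((1ℤ + M) + + 2) * ((1ℤ + M) - + 3)
  step₄ = begin
    + 6 * (0ℤ + a₄ + a₃ + (M - + 2) + 1ℤ + 0ℤ)
      ≡⟨ solve (M ∷ a₃ ∷ a₄ ∷ []) ⟩
    + 6 * a₄ + + 3 * (+ 2 * a₃) + (+ 6 * M - + 6)
      ≡⟨ cong₂ (λ x y → x + + 3 * y + (+ 6 * M - + 6)) h₄ h₃ ⟩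
    (M - + 2) * (M + + 2) * (M - + 3) + + 3 * (M * (M - + 3)) + (+ 6 * M - + 6)
      ≡⟨ solve (M ∷ []) ⟩
    ((1ℤ + M) - + 2) * ((1ℤ + M) + + 2) * ((1ℤ + M) - + 3) ∎

LowCoefficients : ℕ → Set
LowCoefficients m = LowFormulas (+ m) (d m 0) (d m 1) (d m 2) (d m 3) (d m 4)

low-coefficients : ∀ n → LowCoefficients (5 ℕ.+ n)
low-coefficients zero    = low-formulas refl refl refl refl refl
low-coefficients (suc n) =
  LowFormulas-resp (by-d-low z≤n) (by-d-low (s≤s z≤n)) (by-d-low (s≤s (s≤s z≤n)))
                   (by-d-low (s≤s (s≤s (s≤s z≤n)))) (by-d-low (s≤s (s≤s (s≤s (s≤s z≤n)))))
    (low-formulas-step (low-coefficients n))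
  where
  by-d-low : ∀ {k} → k ≤ 4 ℕ.+ n → sumBelow (suc k) (λ j → d (5 ℕ.+ n) (k ∸ j)) ≡ d (6 ℕ.+ n) k
  by-d-low k≤4+n = sym (d-low (4 ℕ.+ n) k≤4+n)

-- s stands for (-1)^m; the formulas are scaled to have integer right-hand sides.
record TopFormulas (M s t₀ t₁ t₂ t₃ : ℤ) : Set where
  constructor top-formulas
  field
    eq₀ : + 2 * t₀ ≡ 1ℤ + s
    eq₁ : + 4 * t₁ ≡ + 2 * M - + 3 - s
    eq₂ : + 8 * t₂ ≡ + 2 * (M * M) - + 4 * M + 1ℤ - s
    eq₃ : + 48 * t₃ ≡ + 4 * (M * M * M) - + 6 * (M * M) - + 4 * M - + 45 - + 3 * s

TopFormulas-resp : ∀ {M s t₀ t₁ t₂ t₃ u₀ u₁ u₂ u₃} →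
  t₀ ≡ u₀ → t₁ ≡ u₁ → t₂ ≡ u₂ → t₃ ≡ u₃ →
  TopFormulas M s t₀ t₁ t₂ t₃ → TopFormulas M s u₀ u₁ u₂ u₃
TopFormulas-resp refl refl refl refl formulas = formulas

top-formulas-step : ∀ {M s t₀ t₁ t₂ t₃} → TopFormulas M s t₀ t₁ t₂ t₃ →
  TopFormulas (1ℤ + M) (- s) (0ℤ + t₀ + - s) (0ℤ + t₀ + t₁ + 0ℤ)
                             (0ℤ + t₀ + t₁ + t₂ + 0ℤ) (0ℤ + t₀ + t₁ + t₂ + t₃ + 0ℤ)
top-formulas-step {M} {s} {t₀} {t₁} {t₂} {t₃} (top-formulas h₀ h₁ h₂ h₃) =
  top-formulas step₀ step₁ step₂ step₃
  where
  step₀ : + 2 * (0ℤ + t₀ + - s) ≡ 1ℤ + - s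
  step₀ = begin
    + 2 * (0ℤ + t₀ + - s) ≡⟨ solve (s ∷ t₀ ∷ []) ⟩
    + 2 * t₀ - + 2 * s    ≡⟨ cong (_- + 2 * s) h₀ ⟩
    1ℤ + s - + 2 * s      ≡⟨ solve (s ∷ []) ⟩
    1ℤ + - s              ∎
  step₁ : + 4 * (0ℤ + t₀ + t₁ + 0ℤ) ≡ + 2 * (1ℤ + M) - + 3 - - s
  step₁ = begin
    + 4 * (0ℤ + t₀ + t₁ + 0ℤ)                 ≡⟨ solve (t₀ ∷ t₁ ∷ []) ⟩
    + 2 * (+ 2 * t₀) + + 4 * t₁               ≡⟨ cong₂ (λ x y → + 2 * x + y) h₀ h₁ ⟩
    + 2 * (1ℤ + s) + (+ 2 * M - + 3 - s)      ≡⟨ solve (M ∷ s ∷ []) ⟩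
    + 2 * (1ℤ + M) - + 3 - - s                ∎
  step₂ : + 8 * (0ℤ + t₀ + t₁ + t₂ + 0ℤ)
          ≡ + 2 * ((1ℤ + M) * (1ℤ + M)) - + 4 * (1ℤ + M) + 1ℤ - - s
  step₂ = begin
    + 8 * (0ℤ + t₀ + t₁ + t₂ + 0ℤ)
      ≡⟨ solve (t₀ ∷ t₁ ∷ t₂ ∷ []) ⟩
    + 4 * (+ 2 * t₀) + + 2 * (+ 4 * t₁) + + 8 * t₂
      ≡⟨ cong₂ _+_ (cong₂ (λ x y → + 4 * x + + 2 * y) h₀ h₁) h₂ ⟩
    + 4 * (1ℤ + s) + + 2 * (+ 2 * M - + 3 - s) + (+ 2 * (M * M) - + 4 * M + 1ℤ - s)
      ≡⟨ solve (M ∷ s ∷ []) ⟩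
    + 2 * ((1ℤ + M) * (1ℤ + M)) - + 4 * (1ℤ + M) + 1ℤ - - s ∎
  step₃ : + 48 * (0ℤ + t₀ + t₁ + t₂ + t₃ + 0ℤ)
          ≡ + 4 * ((1ℤ + M) * (1ℤ + M) * (1ℤ + M)) - + 6 * ((1ℤ + M) * (1ℤ + M))
            - + 4 * (1ℤ + M) - + 45 - + 3 * - s
  step₃ = begin
    + 48 * (0ℤ + t₀ + t₁ + t₂ + t₃ + 0ℤ)
      ≡⟨ solve (t₀ ∷ t₁ ∷ t₂ ∷ t₃ ∷ []) ⟩
    + 24 * (+ 2 * t₀) + + 12 * (+ 4 * t₁) + + 6 * (+ 8 * t₂) + + 48 * t₃
      ≡⟨ cong₂ _+_ (cong₂ _+_ (cong₂ (λ x y → + 24 * x + + 12 * y) h₀ h₁) (cong (+ 6 *_) h₂)) h₃ ⟩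
    + 24 * (1ℤ + s) + + 12 * (+ 2 * M - + 3 - s) + + 6 * (+ 2 * (M * M) - + 4 * M + 1ℤ - s)
      + (+ 4 * (M * M * M) - + 6 * (M * M) - + 4 * M - + 45 - + 3 * s)
      ≡⟨ solve (M ∷ s ∷ []) ⟩
    + 4 * ((1ℤ + M) * (1ℤ + M) * (1ℤ + M)) - + 6 * ((1ℤ + M) * (1ℤ + M))
      - + 4 * (1ℤ + M) - + 45 - + 3 * - s ∎

TopCoefficients : ℕ → Set
TopCoefficients m =
  TopFormulas (+ m) (signPow m) (d m (β m)) (d m (β m ∸ 1)) (d m (β m ∸ 2)) (d m (β m ∸ 3))

top-coefficients : ∀ n → TopCoefficients (5 ℕ.+ n)
top-coefficients zero    = top-formulas refl refl refl refl
top-coefficients (suc n) =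
  TopFormulas-resp (by-d-top z≤n) (by-d-top (s≤s z≤n)) (by-d-top (s≤s (s≤s z≤n)))
                   (by-d-top (s≤s (s≤s (s≤s z≤n))))
    (top-formulas-step (top-coefficients n))
  where
  by-d-top : ∀ {i} → i ≤ 4 ℕ.+ n →
    sumBelow (suc i) (λ t → d (5 ℕ.+ n) (β (5 ℕ.+ n) ∸ t)) + constant (signPow (6 ℕ.+ n)) i
      ≡ d (6 ℕ.+ n) (β (6 ℕ.+ n) ∸ i)
  by-d-top i≤4+n = sym (d-top (4 ℕ.+ n) i≤4+n)

signPow-even : ∀ {m} → 2 ∣ m → signPow m ≡ 1ℤ
signPow-even (divides q refl) = signPow-double q
  where
  signPow-double : ∀ q → signPow (q ℕ.* 2) ≡ 1ℤ
  signPow-double zero    = refl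
  signPow-double (suc q) = trans (neg-involutive (signPow (q ℕ.* 2))) (signPow-double q)

halve : ∀ {x y} → + 2 * x ≡ + 2 * y → x ≡ y
halve {x} {y} = *-cancelˡ-≡ (+ 2) x y

even-top-formulas : ∀ {M s t₀ t₁ t₂ t₃} → s ≡ 1ℤ → TopFormulas M s t₀ t₁ t₂ t₃ →
    (+ 2 * t₁ ≡ M - + 2)
  × (+ 4 * t₂ ≡ M * M - + 2 * M)
  × (+ 24 * t₃ ≡ + 2 * (M * M * M) - + 3 * (M * M) - + 2 * M - + 24)
even-top-formulas {M} {t₁ = t₁} {t₂} {t₃} refl (top-formulas _ h₁ h₂ h₃) =
  halve (begin
    + 2 * (+ 2 * t₁)     ≡⟨ solve (t₁ ∷ []) ⟩
    + 4 * t₁             ≡⟨ h₁ ⟩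
    + 2 * M - + 3 - 1ℤ   ≡⟨ solve (M ∷ []) ⟩
    + 2 * (M - + 2)      ∎) ,
  halve (begin
    + 2 * (+ 4 * t₂)                      ≡⟨ solve (t₂ ∷ []) ⟩
    + 8 * t₂                              ≡⟨ h₂ ⟩
    + 2 * (M * M) - + 4 * M + 1ℤ - 1ℤ     ≡⟨ solve (M ∷ []) ⟩
    + 2 * (M * M - + 2 * M)               ∎) ,
  halve (begin
    + 2 * (+ 24 * t₃)                                               ≡⟨ solve (t₃ ∷ []) ⟩
    + 48 * t₃                                                       ≡⟨ h₃ ⟩
    + 4 * (M * M * M) - + 6 * (M * M) - + 4 * M - + 45 - + 3 * 1ℤ   ≡⟨ solve (M ∷ []) ⟩
    + 2 * (+ 2 * (M * M * M) - + 3 * (M * M) - + 2 * M - + 24)      ∎)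

lemma2 : (m : ℕ) → 2 ∣ m → 6 ≤ m →
    let M = + m in
      (+ 2 * A m (β m ∸ 1) ≡ M - + 2)
    × (A m 2 ≡ M - + 2)
    × (+ 2 * A m 3 ≡ M * (M - + 3))
    × (+ 4 * A m (β m ∸ 2) ≡ M * M - + 2 * M)
    × (+ 6 * A m 4 ≡ (M - + 2) * (M + + 2) * (M - + 3))
    × (+ 24 * A m (β m ∸ 3) ≡ + 2 * (M * M * M) - + 3 * (M * M) - + 2 * M - + 24)
lemma2 m 2∣m 6≤m with ℕₚ.m≤n⇒∃[o]m+o≡n (ℕₚ.<⇒≤ 6≤m)
... | n , refl =
  let top₁ , top₂ , top₃ = even-top-formulas (signPow-even 2∣m) (top-coefficients n)
      open LowFormulas (low-coefficients n)
  in top₁ , eq₂ , eq₃ , top₂ , eq₄ , top₃
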